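{- A chordal graph $G$ does not contain $\mathcal H$ as an induced minor if and only if, for every two disjoint sets $A,B\subseteq V(G)$, each inducing a connected subgraph, with $E(A,B)=\emptyset$, every minimal $A$–$B$ separator disjoint from $A\cup B$ is finite.
   Context: A graph is chordal if it has no induced cycle of length at least four. $\mathcal H$ denotes the graph obtained from an infinite clique by adding two non-adjacent vertices each adjacent to all vertices of the clique. $H$ is an induced minor of $G$ if there are disjoint connected subgraphs $B_v\subseteq G$ ($v\in V(H)$) such that for distinct $u,v$ there is a $B_u$–$B_v$ edge in $G$ precisely when $uv\in E(H)$. $E(A,B)$ is the set of edges with one end in $A$ and the other in $B$. An $A$–$B$ path meets $A$ only in its first vertex and $B$ only in its last vertex; $S\subseteq V(G)$ is an $A$–$B$ separator if $G-S$ has no $A$–$B$ path, and it is minimal if no proper subset of $S$ is an $A$–$B$ separator. -}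

module Defs where

open import Level using (Level; 0ℓ) renaming (suc to lsuc)
open import Data.Nat using (ℕ; zero; suc; _+_; _%_)
open import Data.Fin using (Fin; zero; suc; toℕ; inject₁; fromℕ)
open import Data.Product using (Σ; ∃; _×_; _,_)
open import Data.Sum using (_⊎_; inj₁; inj₂)
open import Data.Bool using (Bool)
open import Data.Empty using (⊥)
open import Data.Unit using (⊤; tt)
open import Data.List using (List)
open import Data.List.Membership.Propositional using (_∈_)
open import Relation.Nullary using (¬_)
open import Relation.Binary.PropositionalEquality using (_≡_; _≢_; refl; sym)
open import Function.Definitions using (Injective)
open import Function.Bundles using (_⇔_)

record Graph : Set₁ where
  field
    V     : Set
    _~_   : V → V → Set
    ~-sym : ∀ {x y} → x ~ y → y ~ x
    ~-irr : ∀ {x} → ¬ (x ~ x)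

Subset : Set → Set₁
Subset V = V → Set

module _ (G : Graph) where
  open Graph G

  IsPath : (n : ℕ) → (Fin (suc n) → V) → Set
  IsPath n p = Injective _≡_ _≡_ p × (∀ (i : Fin n) → p (inject₁ i) ~ p (suc i))

  PathIn : Subset V → (n : ℕ) → (Fin (suc n) → V) → Set
  PathIn X n p = IsPath n p × (∀ i → X (p i))

  InducesConnected : Subset V → Set
  InducesConnected X =
    Σ V X × (∀ x y → X x → X y →
      Σ ℕ λ n → Σ (Fin (suc n) → V) λ p →
        PathIn X n p × p zero ≡ x × p (fromℕ n) ≡ y)

  IsABPath : Subset V → Subset V → (n : ℕ) → (Fin (suc n) → V) → Set
  IsABPath A B n p =
    IsPath n p × A (p zero) × B (p (fromℕ n))
    × (∀ i → A (p i) → i ≡ zero) × (∀ i → B (p i) → i ≡ fromℕ n)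

  IsSeparator : Subset V → Subset V → Subset V → Set
  IsSeparator A B S =
    ¬ (Σ ℕ λ n → Σ (Fin (suc n) → V) λ p → IsABPath A B n p × (∀ i → ¬ S (p i)))

  _⊆_ : Subset V → Subset V → Set
  X ⊆ Y = ∀ x → X x → Y x

  IsMinimalSeparator : Subset V → Subset V → Subset V → Set₁
  IsMinimalSeparator A B S =
    IsSeparator A B S × (∀ S' → S' ⊆ S → IsSeparator A B S' → S ⊆ S')

  NoEdgesBetween : Subset V → Subset V → Set
  NoEdgesBetween A B = ∀ x y → A x → B y → ¬ (x ~ y)

  Disjoint : Subset V → Subset V → Set
  Disjoint A B = ∀ x → A x → B x → ⊥

  FiniteSet : Subset V → Set
  FiniteSet S = Σ (List V) λ xs → ∀ x → S x → x ∈ xs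

  CycAdj : (n : ℕ) → Fin (4 + n) → Fin (4 + n) → Set
  CycAdj n i j = (suc (toℕ i) % (4 + n) ≡ toℕ j) ⊎ (suc (toℕ j) % (4 + n) ≡ toℕ i)

  IsInducedCycle : (n : ℕ) → (Fin (4 + n) → V) → Set
  IsInducedCycle n c = Injective _≡_ _≡_ c × (∀ i j → (c i ~ c j) ⇔ CycAdj n i j)

  Chordal : Set
  Chordal = ∀ n (c : Fin (4 + n) → V) → ¬ IsInducedCycle n c

IsInducedMinor : Graph → Graph → Set₁
IsInducedMinor H G =
  Σ (Graph.V H → Subset (Graph.V G)) λ Bs →
    (∀ u v x → u ≢ v → Bs u x → Bs v x → ⊥)
    × (∀ u → InducesConnected G (Bs u))
    × (∀ u v → u ≢ v →
        (Σ (Graph.V G) λ x → Σ (Graph.V G) λ y → Bs u x × Bs v y × Graph._~_ G x y)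
          ⇔ Graph._~_ H u v)

-- the graph 𝓗: a (countably) infinite clique on ℕ plus two non-adjacent vertices
-- (inj₂ false, inj₂ true) adjacent to every clique vertex
𝓗-adj : ℕ ⊎ Bool → ℕ ⊎ Bool → Set
𝓗-adj (inj₁ m) (inj₁ n) = m ≢ n
𝓗-adj (inj₁ _) (inj₂ _) = ⊤
𝓗-adj (inj₂ _) (inj₁ _) = ⊤
𝓗-adj (inj₂ _) (inj₂ _) = ⊥

𝓗-sym : ∀ {x y} → 𝓗-adj x y → 𝓗-adj y x
𝓗-sym {inj₁ m} {inj₁ n} p = λ e → p (sym e)
𝓗-sym {inj₁ _} {inj₂ _} p = tt
𝓗-sym {inj₂ _} {inj₁ _} p = tt
𝓗-sym {inj₂ _} {inj₂ _} ()

𝓗-irr : ∀ {x} → ¬ 𝓗-adj x x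
𝓗-irr {inj₁ m} p = p refl
𝓗-irr {inj₂ _} ()

𝓗 : Graph
𝓗 = record { V = ℕ ⊎ Bool ; _~_ = 𝓗-adj ; ~-sym = 𝓗-sym ; ~-irr = 𝓗-irr }

{-# OPTIONS --safe #-}

-- If 𝓗 is an induced minor of G with apex branch sets A and B, let C be the component of
-- G − N(A) containing B and S the set of vertices of N(A) with a neighbour in C.  Then S is
-- a minimal A–B separator avoiding A ∪ B, and every clique branch set touches both A and B,
-- so contains a vertex of S; hence S is infinite.  This direction needs no chordality.
--
-- Conversely, let S be an infinite minimal A–B separator and C_A, C_B the components of
-- G − S containing A and B.  By minimality every vertex of S has neighbours in both.  For
-- non-adjacent s, t ∈ S, induced s–t paths through C_A and through C_B would form an induced
-- cycle of length at least four, so in a chordal graph S is a clique.  Then C_A, C_B and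
-- infinitely many singletons of S are the branch sets of an induced 𝓗 minor.

module Submission where

open import Defs
open import Axiom.ExcludedMiddle using (ExcludedMiddle)
open import Level using (0ℓ; Lift; lift; lower) renaming (suc to lsuc)
open import Data.Bool using (Bool; true; false)
open import Data.Empty using (⊥; ⊥-elim)
open import Data.Fin using (Fin; zero; suc; toℕ; inject₁; fromℕ)
open import Data.Fin.Properties using (toℕ<n; toℕ-injective; toℕ-fromℕ; injective⇒≤)
open import Data.Fin.Relation.Unary.Top using (view; ‵fromℕ; ‵inject₁)
open import Data.List as List using (List; []; _∷_)
open import Data.List.Membership.Propositional using (_∈_)
open import Data.List.Relation.Unary.Any using (here; there; index)
open import Data.List.Relation.Unary.Any.Properties using (lookup-index)
open import Data.Nat using (ℕ; zero; suc; _+_; _<_; _%_; s≤s; _≟_)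
open import Data.Nat.DivMod using (m<n⇒m%n≡m; n%n≡0)
open import Data.Nat.Properties using (suc-injective; ≤-pred; m≤n⇒m<n∨m≡n; <-irrefl; <-cmp; 1+n≰n)
open import Data.Product using (Σ; _×_; _,_; proj₁; proj₂)
open import Data.Sum as Sum using (_⊎_; inj₁; inj₂)
open import Data.Sum.Properties using (inj₁-injective)
open import Data.Unit using (⊤; tt)
open import Function.Bundles using (_⇔_; mk⇔; Equivalence)
open import Function.Definitions using (Injective)
open import Relation.Binary using (tri<; tri≈; tri>)
open import Relation.Binary.PropositionalEquality using (_≡_; _≢_; refl; sym; trans; cong; subst; module ≡-Reasoning)
open import Relation.Nullary using (¬_; Dec; yes; no)

decide : ExcludedMiddle (lsuc 0ℓ) → (P : Set) → Dec P
decide em P with em {Lift (lsuc 0ℓ) P}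
... | yes p = yes (lower p)
... | no ¬p = no (λ p → ¬p (lift p))

stable : ExcludedMiddle (lsuc 0ℓ) → (P : Set) → ¬ ¬ P → P
stable em P ¬¬p with decide em P
... | yes p = p
... | no ¬p = ⊥-elim (¬¬p ¬p)

module _ {X : Set} {Y : X → Set} where

  injection⇒¬finite : (f : ℕ → X) → Injective _≡_ _≡_ f → (∀ n → Y (f n)) →
                      ¬ (Σ (List X) λ xs → ∀ x → Y x → x ∈ xs)
  injection⇒¬finite f f-injective Y-f (xs , covers) = 1+n≰n (injective⇒≤ position-injective)
    where
      position : Fin (suc (List.length xs)) → Fin (List.length xs)
      position i = index (covers (f (toℕ i)) (Y-f (toℕ i)))

      position-injective : Injective _≡_ _≡_ position
      position-injective {i} {j} eq = toℕ-injective (f-injective (begin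
        f (toℕ i)                    ≡⟨ lookup-index (covers (f (toℕ i)) (Y-f (toℕ i))) ⟩
        List.lookup xs (position i) ≡⟨ cong (List.lookup xs) eq ⟩
        List.lookup xs (position j) ≡⟨ sym (lookup-index (covers (f (toℕ j)) (Y-f (toℕ j)))) ⟩
        f (toℕ j)                    ∎))
        where open ≡-Reasoning

  ¬finite⇒injection : ExcludedMiddle (lsuc 0ℓ) → ¬ (Σ (List X) λ xs → ∀ x → Y x → x ∈ xs) →
                      Σ (ℕ → X) λ f → Injective _≡_ _≡_ f × (∀ n → Y (f n))
  ¬finite⇒injection em infinite = f , f-injective , λ n → proj₁ (proj₂ (fresh (prefix n)))
    where
      fresh : (xs : List X) → Σ X λ x → Y x × ¬ x ∈ xs
      fresh xs = stable em _ λ none → infinite (xs , λ x Yx → stable em _ λ x∉xs → none (x , Yx , x∉xs))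

      prefix : ℕ → List X
      f : ℕ → X
      prefix zero    = []
      prefix (suc n) = f n ∷ prefix n
      f n = proj₁ (fresh (prefix n))

      f∉prefix : ∀ n → ¬ f n ∈ prefix n
      f∉prefix n = proj₂ (proj₂ (fresh (prefix n)))

      earlier∈prefix : ∀ {m n} → m < n → f m ∈ prefix n
      earlier∈prefix {m} {suc n} (s≤s m≤n) with m≤n⇒m<n∨m≡n m≤n
      ... | inj₁ m<n  = there (earlier∈prefix m<n)
      ... | inj₂ refl = here refl

      f-injective : Injective _≡_ _≡_ f
      f-injective {m} {n} eq with <-cmp m n
      ... | tri< m<n _ _ = ⊥-elim (f∉prefix n (subst (_∈ prefix n) eq (earlier∈prefix m<n)))
      ... | tri≈ _ m≡n _ = m≡n
      ... | tri> _ _ n<m = ⊥-elim (f∉prefix m (subst (_∈ prefix m) (sym eq) (earlier∈prefix n<m)))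

module Walks (G : Graph) where
  open Graph G

  infixr 5 _∷⟨_⟩_ _++_
  infix 30 _‼_

  data Walk : V → V → Set where
    [_]    : (x : V) → Walk x x
    _∷⟨_⟩_ : (x : V) {y z : V} → x ~ y → Walk y z → Walk x z

  private
    variable
      x y z u : V
      P Q : V → Set

  length : Walk x y → ℕ
  length [ _ ]        = zero
  length (_ ∷⟨ _ ⟩ w) = suc (length w)

  _‼_ : (w : Walk x y) → Fin (suc (length w)) → V
  [ x ]        ‼ zero  = x
  (x ∷⟨ _ ⟩ _) ‼ zero  = x
  (_ ∷⟨ _ ⟩ w) ‼ suc i = w ‼ i

  ‼-first : (w : Walk x y) → w ‼ zero ≡ x
  ‼-first [ _ ]        = refl
  ‼-first (_ ∷⟨ _ ⟩ _) = refl

  ‼-last : (w : Walk x y) → w ‼ fromℕ (length w) ≡ y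
  ‼-last [ _ ]        = refl
  ‼-last (_ ∷⟨ _ ⟩ w) = ‼-last w

  ‼-adjacent : (w : Walk x y) (i : Fin (length w)) → w ‼ inject₁ i ~ w ‼ suc i
  ‼-adjacent (x ∷⟨ e ⟩ w) zero    = subst (x ~_) (sym (‼-first w)) e
  ‼-adjacent (_ ∷⟨ _ ⟩ w) (suc i) = ‼-adjacent w i

  ‼-successor-adjacent : (w : Walk x y) (i j : Fin (suc (length w))) →
                         suc (toℕ i) ≡ toℕ j → w ‼ i ~ w ‼ j
  ‼-successor-adjacent (x ∷⟨ e ⟩ w) zero    (suc zero) _ = subst (x ~_) (sym (‼-first w)) e
  ‼-successor-adjacent (_ ∷⟨ _ ⟩ w) (suc i) (suc j)    q = ‼-successor-adjacent w i j (suc-injective q)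

  All : (V → Set) → Walk x y → Set
  All P [ x ]        = P x
  All P (x ∷⟨ _ ⟩ w) = P x × All P w

  AllTail : (V → Set) → Walk x y → Set
  AllTail P [ _ ]        = ⊤
  AllTail P (_ ∷⟨ _ ⟩ w) = All P w

  AllInit : (V → Set) → Walk x y → Set
  AllInit P [ _ ]        = ⊤
  AllInit P (x ∷⟨ _ ⟩ w) = P x × AllInit P w

  AllInner : (V → Set) → Walk x y → Set
  AllInner P [ _ ]        = ⊤
  AllInner P (_ ∷⟨ _ ⟩ w) = AllInit P w

  Any : (V → Set) → Walk x y → Set
  Any P [ x ]        = P x
  Any P (x ∷⟨ _ ⟩ w) = P x ⊎ Any P w

  _⊆ʷ_ : Walk x y → Walk z u → Set₁
  w ⊆ʷ v = ∀ P → All P v → All P w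

  All-first : (w : Walk x y) → All P w → P x
  All-first [ _ ]        p       = p
  All-first (_ ∷⟨ _ ⟩ _) (p , _) = p

  All-last : (w : Walk x y) → All P w → P y
  All-last [ _ ]        p       = p
  All-last (_ ∷⟨ _ ⟩ w) (_ , a) = All-last w a

  All-map : (∀ {v} → P v → Q v) → (w : Walk x y) → All P w → All Q w
  All-map f [ _ ]        p       = f p
  All-map f (_ ∷⟨ _ ⟩ w) (p , a) = f p , All-map f w a

  AllInit-map : (∀ {v} → P v → Q v) → (w : Walk x y) → AllInit P w → AllInit Q w
  AllInit-map f [ _ ]        _       = tt
  AllInit-map f (_ ∷⟨ _ ⟩ w) (p , a) = f p , AllInit-map f w a

  AllTail-map : (∀ {v} → P v → Q v) → (w : Walk x y) → AllTail P w → AllTail Q w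
  AllTail-map f [ _ ]        _ = tt
  AllTail-map f (_ ∷⟨ _ ⟩ w) a = All-map f w a

  All-zipWith : ∀ {R : V → Set} → (∀ {v} → P v → Q v → R v) → (w : Walk x y) → All P w → All Q w → All R w
  All-zipWith f [ _ ]        p       q       = f p q
  All-zipWith f (_ ∷⟨ _ ⟩ w) (p , a) (q , b) = f p q , All-zipWith f w a b

  AllInit-zipWith : ∀ {R : V → Set} → (∀ {v} → P v → Q v → R v) →
                    (w : Walk x y) → AllInit P w → AllInit Q w → AllInit R w
  AllInit-zipWith f [ _ ]        _       _       = tt
  AllInit-zipWith f (_ ∷⟨ _ ⟩ w) (p , a) (q , b) = f p q , AllInit-zipWith f w a b

  All⇒AllInit : (w : Walk x y) → All P w → AllInit P w
  All⇒AllInit [ _ ]        _       = tt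
  All⇒AllInit (_ ∷⟨ _ ⟩ w) (p , a) = p , All⇒AllInit w a

  AllTail⇒All : (w : Walk x y) → P x → AllTail P w → All P w
  AllTail⇒All [ _ ]        p _ = p
  AllTail⇒All (_ ∷⟨ _ ⟩ _) p a = p , a

  All⇒AllTail : (w : Walk x y) → All P w → AllTail P w
  All⇒AllTail [ _ ]        _       = tt
  All⇒AllTail (_ ∷⟨ _ ⟩ _) (_ , a) = a

  AllInit⇒AllInner : (w : Walk x y) → AllInit P w → AllInner P w
  AllInit⇒AllInner [ _ ]        _       = tt
  AllInit⇒AllInner (_ ∷⟨ _ ⟩ _) (_ , a) = a

  AllTail⇒All-or-first : (w : Walk x y) → AllTail P w → All (λ v → v ≡ x ⊎ P v) w
  AllTail⇒All-or-first [ _ ]        _ = inj₁ refl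
  AllTail⇒All-or-first (_ ∷⟨ _ ⟩ w) a = inj₁ refl , All-map inj₂ w a

  AllInit⇒All-or-last : (w : Walk x y) → AllInit P w → All (λ v → v ≡ y ⊎ P v) w
  AllInit⇒All-or-last [ _ ]        _       = inj₁ refl
  AllInit⇒All-or-last (_ ∷⟨ _ ⟩ w) (p , a) = inj₂ p , AllInit⇒All-or-last w a

  All-‼ : (w : Walk x y) → All P w → ∀ i → P (w ‼ i)
  All-‼ [ _ ]        p       zero    = p
  All-‼ (_ ∷⟨ _ ⟩ _) (p , _) zero    = p
  All-‼ (_ ∷⟨ _ ⟩ w) (_ , a) (suc i) = All-‼ w a i

  AllInit-‼ : (w : Walk x y) → AllInit P w → ∀ (i : Fin (length w)) → P (w ‼ inject₁ i)
  AllInit-‼ (_ ∷⟨ _ ⟩ _) (p , _) zero    = p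
  AllInit-‼ (_ ∷⟨ _ ⟩ w) (_ , a) (suc i) = AllInit-‼ w a i

  AllTail-‼ : (w : Walk x y) → AllTail P w → ∀ (i : Fin (length w)) → P (w ‼ suc i)
  AllTail-‼ (_ ∷⟨ _ ⟩ w) a i = All-‼ w a i

  Any-first : (w : Walk x y) → P x → Any P w
  Any-first [ _ ]        p = p
  Any-first (_ ∷⟨ _ ⟩ _) p = inj₁ p

  Any-last : (w : Walk x y) → P y → Any P w
  Any-last [ _ ]        p = p
  Any-last (_ ∷⟨ _ ⟩ w) p = inj₂ (Any-last w p)

  ¬Any⇒All¬ : (w : Walk x y) → ¬ Any P w → All (λ v → ¬ P v) w
  ¬Any⇒All¬ [ _ ]        ¬p = ¬p
  ¬Any⇒All¬ (_ ∷⟨ _ ⟩ w) ¬p = (λ p → ¬p (inj₁ p)) , ¬Any⇒All¬ w (λ p → ¬p (inj₂ p))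

  _++_ : Walk x y → Walk y z → Walk x z
  [ _ ]        ++ v = v
  (x ∷⟨ e ⟩ w) ++ v = x ∷⟨ e ⟩ (w ++ v)

  All-++ : (w : Walk x y) (v : Walk y z) → All P w → AllTail P v → All P (w ++ v)
  All-++ [ _ ]        v p       a = AllTail⇒All v p a
  All-++ (_ ∷⟨ _ ⟩ w) v (p , a) b = p , All-++ w v a b

  AllTail-++ : (w : Walk x y) (v : Walk y z) → AllTail P w → AllTail P v → AllTail P (w ++ v)
  AllTail-++ [ _ ]        v _ b = b
  AllTail-++ (_ ∷⟨ _ ⟩ w) v a b = All-++ w v a b

  AllInit-++ : (w : Walk x y) (v : Walk y z) → All P w → AllInit P v → AllInit P (w ++ v)
  AllInit-++ [ _ ]        v _       b = b
  AllInit-++ (_ ∷⟨ _ ⟩ w) v (p , a) b = p , AllInit-++ w v a b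

  AllInner-++ : (w : Walk x y) (v : Walk y z) → AllTail P w → AllInit P v → AllInner P (w ++ v)
  AllInner-++ [ _ ]        v _ b = AllInit⇒AllInner v b
  AllInner-++ (_ ∷⟨ _ ⟩ w) v a b = AllInit-++ w v a b

  Any-++ˡ : (w : Walk x y) (v : Walk y z) → Any P w → Any P (w ++ v)
  Any-++ˡ [ _ ]        v p        = Any-first v p
  Any-++ˡ (_ ∷⟨ _ ⟩ w) v (inj₁ p) = inj₁ p
  Any-++ˡ (_ ∷⟨ _ ⟩ w) v (inj₂ p) = inj₂ (Any-++ˡ w v p)

  Any-++ʳ : (w : Walk x y) (v : Walk y z) → Any P v → Any P (w ++ v)
  Any-++ʳ [ _ ]        v p = p
  Any-++ʳ (_ ∷⟨ _ ⟩ w) v p = inj₂ (Any-++ʳ w v p)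

  reverse : Walk x y → Walk y x
  reverse [ x ]        = [ x ]
  reverse (x ∷⟨ e ⟩ w) = reverse w ++ (_ ∷⟨ ~-sym e ⟩ [ x ])

  All-reverse : (w : Walk x y) → All P w → All P (reverse w)
  All-reverse [ _ ]        p       = p
  All-reverse (_ ∷⟨ _ ⟩ w) (p , a) = All-++ (reverse w) _ (All-reverse w a) p

  Any-reverse : (w : Walk x y) → Any P w → Any P (reverse w)
  Any-reverse [ _ ]        p        = p
  Any-reverse (_ ∷⟨ _ ⟩ w) (inj₁ p) = Any-++ʳ (reverse w) _ (inj₂ p)
  Any-reverse (_ ∷⟨ _ ⟩ w) (inj₂ p) = Any-++ˡ (reverse w) _ (Any-reverse w p)

  IsInduced : Walk x y → Set
  IsInduced [ _ ]        = ⊤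
  IsInduced (x ∷⟨ _ ⟩ w) = All (x ≢_) w × AllTail (λ v → ¬ x ~ v) w × IsInduced w

  induced-init-≢-last : (w : Walk x y) → IsInduced w → AllInit (_≢ y) w
  induced-init-≢-last [ _ ]        _             = tt
  induced-init-≢-last (_ ∷⟨ _ ⟩ w) (≢w , _ , ind) = All-last w ≢w , induced-init-≢-last w ind

  induced-tail : (w : Walk x y) → IsInduced w → All (λ v → v ≡ x ⊎ P v) w → AllTail P w
  induced-tail [ _ ]        _            _       = tt
  induced-tail {P = P} (x ∷⟨ _ ⟩ w) (x∉w , _ , _) (_ , a) = All-zipWith {P = x ≢_} other-than-first w x∉w a
    where
      other-than-first : ∀ {v} → x ≢ v → v ≡ x ⊎ P v → P v
      other-than-first x≢v (inj₁ v≡x) = ⊥-elim (x≢v (sym v≡x))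
      other-than-first _   (inj₂ p)   = p

  induced-init : (w : Walk x y) → IsInduced w → All (λ v → v ≡ y ⊎ P v) w → AllInit P w
  induced-init {y = y} {P = P} w ind a =
    AllInit-zipWith {P = _≢ y} other-than-last w (induced-init-≢-last w ind) (All⇒AllInit w a)
    where
      other-than-last : ∀ {v} → v ≢ y → v ≡ y ⊎ P v → P v
      other-than-last v≢y (inj₁ v≡y) = ⊥-elim (v≢y v≡y)
      other-than-last _   (inj₂ p)   = p

  ‼-injective : (w : Walk x y) → IsInduced w → Injective _≡_ _≡_ (w ‼_)
  ‼-injective [ _ ]        _             {zero}  {zero}  _  = refl
  ‼-injective (_ ∷⟨ _ ⟩ _) _             {zero}  {zero}  _  = refl
  ‼-injective (_ ∷⟨ _ ⟩ w) (x∉w , _ , _) {zero}  {suc j} eq = ⊥-elim (All-‼ w x∉w j eq)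
  ‼-injective (_ ∷⟨ _ ⟩ w) (x∉w , _ , _) {suc i} {zero}  eq = ⊥-elim (All-‼ w x∉w i (sym eq))
  ‼-injective (_ ∷⟨ _ ⟩ w) (_ , _ , ind) {suc i} {suc j} eq = cong suc (‼-injective w ind eq)

  induced⇒IsPath : (w : Walk x y) → IsInduced w → IsPath G (length w) (w ‼_)
  induced⇒IsPath w ind = ‼-injective w ind , ‼-adjacent w

  induced-‼-adjacent : (w : Walk x y) → IsInduced w → ∀ i j → w ‼ i ~ w ‼ j →
                       suc (toℕ i) ≡ toℕ j ⊎ suc (toℕ j) ≡ toℕ i
  induced-‼-adjacent [ _ ]        _ zero zero a = ⊥-elim (~-irr a)
  induced-‼-adjacent (_ ∷⟨ _ ⟩ _) _ zero zero a = ⊥-elim (~-irr a)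
  induced-‼-adjacent (_ ∷⟨ _ ⟩ _) _ zero (suc zero) _ = inj₁ refl
  induced-‼-adjacent (_ ∷⟨ _ ⟩ _) _ (suc zero) zero _ = inj₂ refl
  induced-‼-adjacent (_ ∷⟨ _ ⟩ w) (_ , no-chord , _) zero (suc (suc j)) a =
    ⊥-elim (AllTail-‼ w no-chord j a)
  induced-‼-adjacent (_ ∷⟨ _ ⟩ w) (_ , no-chord , _) (suc (suc i)) zero a =
    ⊥-elim (AllTail-‼ w no-chord i (~-sym a))
  induced-‼-adjacent (_ ∷⟨ _ ⟩ w) (_ , _ , ind) (suc i) (suc j) a with induced-‼-adjacent w ind i j a
  ... | inj₁ q = inj₁ (cong suc q)
  ... | inj₂ q = inj₂ (cong suc q)

  ++-induced : (w : Walk x y) (v : Walk y z) → IsInduced w → IsInduced v →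
               AllInit (λ a → AllTail (λ b → a ≢ b × ¬ a ~ b) v) w → IsInduced (w ++ v)
  ++-induced [ _ ]        v _                       ind-v _            = ind-v
  ++-induced (x ∷⟨ _ ⟩ w) v (x∉w , no-chord , ind-w) ind-v (x-v , w-v) =
    All-++ w v x∉w (AllTail-map proj₁ v x-v) ,
    AllTail-++ w v no-chord (AllTail-map proj₂ v x-v) ,
    ++-induced w v ind-w ind-v w-v

  path⇒walk : ∀ n (p : Fin (suc n) → V) → (∀ i → p (inject₁ i) ~ p (suc i)) →
              Σ (Walk (p zero) (p (fromℕ n))) λ w → ∀ P → (∀ i → P (p i)) → All P w
  path⇒walk zero    p _   = [ p zero ] , λ _ P-p → P-p zero
  path⇒walk (suc n) p adj with path⇒walk n (λ i → p (suc i)) (λ i → adj (suc i))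
  ... | w , w⊆p = p zero ∷⟨ adj zero ⟩ w , λ P P-p → P-p zero , w⊆p P (λ i → P-p (suc i))

  connected⇒walk : ∀ {X} → InducesConnected G X → X x → X y → Σ (Walk x y) (All X)
  connected⇒walk {x = x} {y = y} {X = X} (_ , connect) Xx Xy with connect x y Xx Xy
  ... | n , p , ((_ , adj) , X-p) , refl , refl with path⇒walk n p adj
  ...   | w , w⊆p = w , w⊆p X X-p

  only-at-first : (w : Walk x y) → IsInduced w → All (λ v → v ≡ x ⊎ ¬ P v) w →
                  ∀ i → P (w ‼ i) → i ≡ zero
  only-at-first w ind a i p with All-‼ w a i
  ... | inj₁ eq = ‼-injective w ind (trans eq (sym (‼-first w)))
  ... | inj₂ ¬p = ⊥-elim (¬p p)

  only-at-last : (w : Walk x y) → IsInduced w → All (λ v → v ≡ y ⊎ ¬ P v) w →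
                 ∀ i → P (w ‼ i) → i ≡ fromℕ (length w)
  only-at-last w ind a i p with All-‼ w a i
  ... | inj₁ eq = ‼-injective w ind (trans eq (sym (‼-last w)))
  ... | inj₂ ¬p = ⊥-elim (¬p p)

  Boundary : Subset V → Subset V
  Boundary X v = ¬ X v × Σ V λ a → X a × a ~ v

  boundary-free-walk⇒outside : ∀ {X} (w : Walk x y) → All (λ v → ¬ Boundary X v) w → ¬ X y → ¬ X x
  boundary-free-walk⇒outside [ _ ]        _            ¬Xy = ¬Xy
  boundary-free-walk⇒outside (x ∷⟨ e ⟩ w) (_ , ∂-free) ¬Xy Xx =
    All-first w ∂-free (boundary-free-walk⇒outside w ∂-free ¬Xy , x , Xx , e)

module ClassicalWalks (G : Graph) (em : ExcludedMiddle (lsuc 0ℓ)) where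
  open Graph G
  open Walks G

  private
    variable
      x y z : V

  first-hit : (Q : V → Set) (w : Walk x y) → Any Q w →
              Σ V λ z → Σ (Walk x z) λ p → Q z × AllInit (λ v → ¬ Q v) p × p ⊆ʷ w
  first-hit Q [ x ]        q = x , [ x ] , q , tt , λ _ a → a
  first-hit Q (x ∷⟨ e ⟩ w) h with decide em (Q x) | h
  ... | yes q  | _      = x , [ x ] , q , tt , λ _ → proj₁
  ... | no ¬q  | inj₁ q = ⊥-elim (¬q q)
  ... | no ¬q  | inj₂ h′ with first-hit Q w h′
  ...   | z , p , qz , ¬Q , p⊆w = z , x ∷⟨ e ⟩ p , qz , (¬q , ¬Q) , λ P (px , a) → px , p⊆w P a

  last-hit : (Q : V → Set) (w : Walk x y) → Any Q w →
             Σ V λ z → Σ (Walk z y) λ p → Q z × AllTail (λ v → ¬ Q v) p × p ⊆ʷ w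
  last-hit Q [ x ]        q = x , [ x ] , q , tt , λ _ a → a
  last-hit Q (x ∷⟨ e ⟩ w) h with decide em (Any Q w) | h
  ... | yes h′ | _       = let (z , p , qz , ¬Q , p⊆w) = last-hit Q w h′ in
                           z , p , qz , ¬Q , λ P a → p⊆w P (proj₂ a)
  ... | no ¬h′ | inj₁ q  = x , x ∷⟨ e ⟩ w , q , ¬Any⇒All¬ w ¬h′ , λ _ a → a
  ... | no ¬h′ | inj₂ h′ = ⊥-elim (¬h′ h′)

  Touches : V → V → Set
  Touches x v = x ≡ v ⊎ x ~ v

  adjacent⇒≢ : x ~ y → x ≢ y
  adjacent⇒≢ e refl = ~-irr e

  enter-at-head : (x : V) (w : Walk y z) → IsInduced w → Touches x y → AllTail (λ v → ¬ Touches x v) w →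
                  Σ (Walk x z) λ p → IsInduced p × (∀ P → P x → All P w → All P p)
  enter-at-head x w ind (inj₁ refl) _   = w , ind , λ _ _ a → a
  enter-at-head x w ind (inj₂ x~y)  far =
    x ∷⟨ x~y ⟩ w ,
    (AllTail⇒All w (adjacent⇒≢ x~y) (AllTail-map (λ ¬t x≡v → ¬t (inj₁ x≡v)) w far) ,
     AllTail-map (λ ¬t x~v → ¬t (inj₂ x~v)) w far ,
     ind) ,
    λ _ px a → px , a

  -- Enter w at the last vertex equal or adjacent to x.
  shortcut : (x : V) (w : Walk y z) → IsInduced w → Any (Touches x) w →
             Σ (Walk x z) λ p → IsInduced p × (∀ P → P x → All P w → All P p)
  shortcut x [ y ] _ t = enter-at-head x [ y ] tt t tt
  shortcut x (y ∷⟨ e ⟩ w) ind h with decide em (Any (Touches x) w) | h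
  ... | yes h′ | _       = let (p , ind-p , p⊆) = shortcut x w (proj₂ (proj₂ ind)) h′ in
                           p , ind-p , λ P px a → p⊆ P px (proj₂ a)
  ... | no ¬h′ | inj₁ t  = enter-at-head x (y ∷⟨ e ⟩ w) ind t (¬Any⇒All¬ w ¬h′)
  ... | no ¬h′ | inj₂ h′ = ⊥-elim (¬h′ h′)

  induced-subpath : (w : Walk x y) → Σ (Walk x y) λ p → IsInduced p × p ⊆ʷ w
  induced-subpath [ x ]        = [ x ] , tt , λ _ a → a
  induced-subpath (x ∷⟨ e ⟩ w) with induced-subpath w
  ... | p , ind , p⊆w with shortcut x p ind (Any-first p (inj₂ e))
  ...   | q , ind-q , q⊆ = q , ind-q , λ P (px , a) → q⊆ P px (p⊆w P a)

  induced-path-to : (Q : V → Set) (w : Walk x y) → Any Q w →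
                    Σ V λ z → Σ (Walk x z) λ p → Q z × IsInduced p × AllInit (λ v → ¬ Q v) p × p ⊆ʷ w
  induced-path-to Q w h with first-hit Q w h
  ... | z , p , qz , ¬Q , p⊆w with induced-subpath p
  ...   | q , ind , q⊆p =
    z , q , qz , ind , induced-init q ind (q⊆p _ (AllInit⇒All-or-last p ¬Q)) , λ P a → q⊆p P (p⊆w P a)

  induced-path-from : (Q : V → Set) (w : Walk x y) → Any Q w →
                      Σ V λ z → Σ (Walk z y) λ p → Q z × IsInduced p × AllTail (λ v → ¬ Q v) p × p ⊆ʷ w
  induced-path-from Q w h with last-hit Q w h
  ... | z , p , qz , ¬Q , p⊆w with induced-subpath p
  ...   | q , ind , q⊆p =
    z , q , qz , ind , induced-tail q ind (q⊆p _ (AllTail⇒All-or-first p ¬Q)) , λ P a → q⊆p P (p⊆w P a)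

  walk⇒path : ∀ {X} (w : Walk x y) → All X w →
              Σ ℕ λ n → Σ (Fin (suc n) → V) λ p → PathIn G X n p × p zero ≡ x × p (fromℕ n) ≡ y
  walk⇒path {X = X} w X-w with induced-subpath w
  ... | p , ind , p⊆w = length p , p ‼_ , (induced⇒IsPath p ind , All-‼ p (p⊆w X X-w)) , ‼-first p , ‼-last p

  walks⇒connected : ∀ {X} → Σ V X → (∀ {x y} → X x → X y → Σ (Walk x y) (All X)) → InducesConnected G X
  walks⇒connected inhabited walk =
    inhabited , λ x y Xx Xy → walk⇒path (proj₁ (walk Xx Xy)) (proj₂ (walk Xx Xy))

  -- An A–B path meets A and B only at its ends, hence the cutting and trimming of w.
  separator-blocks : ∀ {A B S} → IsSeparator G A B S → (w : Walk x y) → A x → B y → ¬ All (λ v → ¬ S v) w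
  separator-blocks {A = A} {B} {S} sep w ax by S-free with last-hit A w (Any-first w ax)
  ... | x′ , w₁ , ax′ , ¬A , w₁⊆w with induced-path-to B w₁ (Any-last w₁ by)
  ...   | y′ , p , by′ , ind , ¬B , p⊆w₁ =
    sep (length p , p ‼_ ,
         (induced⇒IsPath p ind ,
          subst A (sym (‼-first p)) ax′ , subst B (sym (‼-last p)) by′ ,
          only-at-first p ind (p⊆w₁ _ (AllTail⇒All-or-first w₁ ¬A)) ,
          only-at-last p ind (AllInit⇒All-or-last p ¬B)) ,
         All-‼ p (p⊆w₁ _ (w₁⊆w _ S-free)))

  separator-meets : ∀ {A B S} → IsSeparator G A B S → (w : Walk x y) → A x → B y → Any S w
  separator-meets {S = S} sep w ax by with decide em (Any S w)
  ... | yes hit = hit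
  ... | no ¬hit = ⊥-elim (separator-blocks sep w ax by (¬Any⇒All¬ w ¬hit))

  ¬separator⇒walk : ∀ {A B S} → ¬ IsSeparator G A B S →
                    Σ V λ x → Σ V λ y → A x × B y × Σ (Walk x y) (All (λ v → ¬ S v))
  ¬separator⇒walk {A} {B} {S} ¬separates
    with stable em (Σ ℕ λ n → Σ (Fin (suc n) → V) λ p → IsABPath G A B n p × (∀ i → ¬ S (p i))) ¬separates
  ... | n , p , ((_ , adj) , A-start , B-end , _ , _) , S-free with path⇒walk n p adj
  ...   | w , w⊆p = _ , _ , A-start , B-end , w , w⊆p _ S-free

  module Component (R T : Subset V) (T∩R=∅ : ∀ {x} → T x → ¬ R x) where

    C : Subset V
    C v = Σ V λ t → T t × Σ (Walk v t) (All (λ u → ¬ R u))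

    T⊆C : T x → C x
    T⊆C {x} Tx = x , Tx , [ x ] , T∩R=∅ Tx

    C∩R=∅ : C x → ¬ R x
    C∩R=∅ (_ , _ , w , R-free) = All-first w R-free

    C-backward : (w : Walk x y) → All (λ v → ¬ R v) w → C y → C x
    C-backward w R-free (t , Tt , w′ , R-free′) = t , Tt , w ++ w′ , All-++ w w′ R-free (All⇒AllTail w′ R-free′)

    R-free-walk⊆C : ∀ {t} (w : Walk x t) → T t → All (λ v → ¬ R v) w → All C w
    R-free-walk⊆C [ _ ]        Tt R-free         = T⊆C Tt
    R-free-walk⊆C (x ∷⟨ e ⟩ w) Tt (¬Rx , R-free) =
      (_ , Tt , x ∷⟨ e ⟩ w , ¬Rx , R-free) , R-free-walk⊆C w Tt R-free

    C-walk : InducesConnected G T → C x → C y → Σ (Walk x y) (All C)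
    C-walk T-conn (t , Tt , wx , R-free-x) (t′ , Tt′ , wy , R-free-y) with connected⇒walk T-conn Tt Tt′
    ... | wt , T-wt =
      wx ++ wt ++ reverse wy ,
      All-++ wx _ (R-free-walk⊆C wx Tt R-free-x) (All⇒AllTail (wt ++ reverse wy)
        (All-++ wt (reverse wy) (All-map T⊆C wt T-wt)
          (All⇒AllTail (reverse wy) (All-reverse wy (R-free-walk⊆C wy Tt′ R-free-y)))))

    C-connected : InducesConnected G T → InducesConnected G C
    C-connected T-conn@((t , Tt) , _) = walks⇒connected (t , T⊆C Tt) (C-walk T-conn)

    boundary-neighbour : (w : Walk x z) → C x → AllInit (λ v → ¬ R v) w → R z → Σ V λ u → C u × u ~ z
    boundary-neighbour [ x ]                    Cx _            Rx = ⊥-elim (C∩R=∅ Cx Rx)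
    boundary-neighbour (x ∷⟨ e ⟩ [ _ ])         Cx _            _  = x , Cx , e
    boundary-neighbour (x ∷⟨ e ⟩ y ∷⟨ e′ ⟩ w) Cx (_ , ¬Ry , a) Rz =
      boundary-neighbour (y ∷⟨ e′ ⟩ w) (C-backward (y ∷⟨ ~-sym e ⟩ [ x ]) (¬Ry , C∩R=∅ Cx) Cx) (¬Ry , a) Rz

    neighbour-of-first-hit : ∀ {s} (w : Walk x y) → T x → Any R w → All (λ v → R v → v ≡ s) w →
                             Σ V λ u → C u × u ~ s
    neighbour-of-first-hit {s = s} w Tx hit only-s with first-hit R w hit
    ... | z , p , Rz , ¬R , p⊆w with All-last p (p⊆w (λ v → R v → v ≡ s) only-s) Rz
    ...   | refl = boundary-neighbour p (T⊆C Tx) ¬R Rz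

module Chordality (G : Graph) where
  open Graph G
  open Walks G

  private
    variable
      x y : V

  CyclicSuccessor : ∀ m → Fin (suc m) → Fin (suc m) → Set
  CyclicSuccessor m i j = (toℕ i ≡ m × toℕ j ≡ 0) ⊎ suc (toℕ i) ≡ toℕ j

  suc-mod : ∀ m (i : Fin (suc m)) →
            (toℕ i ≡ m × suc (toℕ i) % suc m ≡ 0) ⊎ (toℕ i < m × suc (toℕ i) % suc m ≡ suc (toℕ i))
  suc-mod m i with m≤n⇒m<n∨m≡n (≤-pred (toℕ<n i))
  ... | inj₁ i<m = inj₂ (i<m , m<n⇒m%n≡m (s≤s i<m))
  ... | inj₂ i≡m  = inj₁ (i≡m , subst (λ k → suc k % suc m ≡ 0) (sym i≡m) (n%n≡0 (suc m)))

  suc-mod≡⇔CyclicSuccessor : ∀ m (i j : Fin (suc m)) → (suc (toℕ i) % suc m ≡ toℕ j) ⇔ CyclicSuccessor m i j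
  suc-mod≡⇔CyclicSuccessor m i j = mk⇔ to from
    where
      to : suc (toℕ i) % suc m ≡ toℕ j → CyclicSuccessor m i j
      to q with suc-mod m i
      ... | inj₁ (i≡m , wraps) = inj₁ (i≡m , trans (sym q) wraps)
      ... | inj₂ (_ , steps)   = inj₂ (trans (sym steps) q)

      from : CyclicSuccessor m i j → suc (toℕ i) % suc m ≡ toℕ j
      from s with suc-mod m i | s
      ... | inj₁ (_ , wraps)   | inj₁ (_ , j≡0) = trans wraps (sym j≡0)
      ... | inj₁ (i≡m , _)     | inj₂ q         =
        ⊥-elim (<-irrefl refl (subst (_< suc m) (trans (sym q) (cong suc i≡m)) (toℕ<n j)))
      ... | inj₂ (i<m , _)     | inj₁ (i≡m , _) = ⊥-elim (<-irrefl i≡m i<m)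
      ... | inj₂ (_ , steps)   | inj₂ q         = trans steps q

  apex-adjacent⇒end : ∀ {v} (w : Walk x y) → AllInner (λ u → ¬ v ~ u) w →
                      ∀ i → v ~ w ‼ i → toℕ i ≡ 0 ⊎ toℕ i ≡ length w
  apex-adjacent⇒end w            _     zero    _ = inj₁ refl
  apex-adjacent⇒end (_ ∷⟨ _ ⟩ w) inner (suc i) a with view i
  ... | ‵fromℕ     = inj₂ (cong suc (toℕ-fromℕ (length w)))
  ... | ‵inject₁ j = ⊥-elim (AllInit-‼ w inner j a)

  end⇒apex-adjacent : ∀ {v} (w : Walk x y) → v ~ x → v ~ y →
                      ∀ i → toℕ i ≡ 0 ⊎ toℕ i ≡ length w → v ~ w ‼ i
  end⇒apex-adjacent w v~x _ zero _ = subst (_ ~_) (sym (‼-first w)) v~x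
  end⇒apex-adjacent w _ v~y (suc i) (inj₂ i≡len) =
    subst (_ ~_) (trans (sym (‼-last w)) (cong (w ‼_) (toℕ-injective (trans (toℕ-fromℕ _) (sym i≡len))))) v~y

  apex-cycle : V → (w : Walk x y) → Fin (suc (suc (length w))) → V
  apex-cycle v w zero    = v
  apex-cycle v w (suc i) = w ‼ i

  apex-cycle-injective : ∀ {v} (w : Walk x y) → IsInduced w → All (v ≢_) w → Injective _≡_ _≡_ (apex-cycle v w)
  apex-cycle-injective w _   _   {zero}  {zero}  _  = refl
  apex-cycle-injective w _   v∉w {zero}  {suc j} eq = ⊥-elim (All-‼ w v∉w j eq)
  apex-cycle-injective w _   v∉w {suc i} {zero}  eq = ⊥-elim (All-‼ w v∉w i (sym eq))
  apex-cycle-injective w ind _   {suc i} {suc j} eq = cong suc (‼-injective w ind eq)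

  apex-cycle-adjacent⇒successor :
    ∀ {v} (w : Walk x y) → IsInduced w → AllInner (λ u → ¬ v ~ u) w →
    ∀ i j → apex-cycle v w i ~ apex-cycle v w j →
    CyclicSuccessor (suc (length w)) i j ⊎ CyclicSuccessor (suc (length w)) j i
  apex-cycle-adjacent⇒successor w _ _ zero zero a = ⊥-elim (~-irr a)
  apex-cycle-adjacent⇒successor w _ v≁inner zero (suc j) a with apex-adjacent⇒end w v≁inner j a
  ... | inj₁ j≡0   = inj₁ (inj₂ (cong suc (sym j≡0)))
  ... | inj₂ j≡len = inj₂ (inj₁ (cong suc j≡len , refl))
  apex-cycle-adjacent⇒successor w _ v≁inner (suc i) zero a with apex-adjacent⇒end w v≁inner i (~-sym a)
  ... | inj₁ i≡0   = inj₂ (inj₂ (cong suc (sym i≡0)))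
  ... | inj₂ i≡len = inj₁ (inj₁ (cong suc i≡len , refl))
  apex-cycle-adjacent⇒successor w ind _ (suc i) (suc j) a with induced-‼-adjacent w ind i j a
  ... | inj₁ q = inj₁ (inj₂ (cong suc q))
  ... | inj₂ q = inj₂ (inj₂ (cong suc q))

  successor⇒apex-cycle-adjacent :
    ∀ {v} (w : Walk x y) → v ~ x → v ~ y →
    ∀ i j → CyclicSuccessor (suc (length w)) i j → apex-cycle v w i ~ apex-cycle v w j
  successor⇒apex-cycle-adjacent w v~x v~y zero (suc j) (inj₂ q) =
    end⇒apex-adjacent w v~x v~y j (inj₁ (sym (suc-injective q)))
  successor⇒apex-cycle-adjacent w v~x v~y (suc i) zero (inj₁ (q , _)) =
    ~-sym (end⇒apex-adjacent w v~x v~y i (inj₂ (suc-injective q)))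
  successor⇒apex-cycle-adjacent w _ _ (suc i) (suc j) (inj₂ q) = ‼-successor-adjacent w i j (suc-injective q)

  CycAdj⇔CyclicSuccessor : ∀ n (i j : Fin (4 + n)) →
                           CycAdj G n i j ⇔ (CyclicSuccessor (3 + n) i j ⊎ CyclicSuccessor (3 + n) j i)
  CycAdj⇔CyclicSuccessor n i j =
    mk⇔ (Sum.map (Equivalence.to (suc-mod≡⇔CyclicSuccessor (3 + n) i j))
                 (Equivalence.to (suc-mod≡⇔CyclicSuccessor (3 + n) j i)))
        (Sum.map (Equivalence.from (suc-mod≡⇔CyclicSuccessor (3 + n) i j))
                 (Equivalence.from (suc-mod≡⇔CyclicSuccessor (3 + n) j i)))

  chordal-no-hole : Chordal G → ∀ v (w : Walk x y) → IsInduced w → x ≢ y → ¬ x ~ y →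
                    All (v ≢_) w → v ~ x → v ~ y → AllInner (λ u → ¬ v ~ u) w → ⊥
  chordal-no-hole _ _ [ _ ]               _ x≢y _   _ _ _ _ = x≢y refl
  chordal-no-hole _ _ (_ ∷⟨ x~y ⟩ [ _ ]) _ _   x≁y _ _ _ _ = x≁y x~y
  chordal-no-hole chordal v w@(_ ∷⟨ _ ⟩ _ ∷⟨ _ ⟩ w′) ind _ _ v∉w v~x v~y v≁inner =
    chordal (length w′) (apex-cycle v w) (apex-cycle-injective w ind v∉w , λ i j → mk⇔ (to i j) (from i j))
    where
      to : ∀ i j → apex-cycle v w i ~ apex-cycle v w j → CycAdj G (length w′) i j
      to i j a = Equivalence.from (CycAdj⇔CyclicSuccessor (length w′) i j)
                   (apex-cycle-adjacent⇒successor w ind v≁inner i j a)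

      from : ∀ i j → CycAdj G (length w′) i j → apex-cycle v w i ~ apex-cycle v w j
      from i j c with Equivalence.to (CycAdj⇔CyclicSuccessor (length w′) i j) c
      ... | inj₁ i→j = successor⇒apex-cycle-adjacent w v~x v~y i j i→j
      ... | inj₂ j→i = ~-sym (successor⇒apex-cycle-adjacent w v~x v~y j i j→i)

FiniteMinimalSeparators : Graph → Set₁
FiniteMinimalSeparators G =
  ∀ (A B S : Subset (Graph.V G)) →
    Disjoint G A B → InducesConnected G A → InducesConnected G B → NoEdgesBetween G A B →
    IsMinimalSeparator G A B S → (∀ x → S x → ¬ A x × ¬ B x) → FiniteSet G S

module SeparatorOfMinor (G : Graph) (em : ExcludedMiddle (lsuc 0ℓ)) (minor : IsInducedMinor 𝓗 G) where
  open Graph G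
  open Walks G
  open ClassicalWalks G em

  private
    variable
      x y : V

  branch : ℕ ⊎ Bool → Subset V
  branch = proj₁ minor

  branches-disjoint : ∀ u v x → u ≢ v → branch u x → branch v x → ⊥
  branches-disjoint = proj₁ (proj₂ minor)

  branch-connected : ∀ u → InducesConnected G (branch u)
  branch-connected = proj₁ (proj₂ (proj₂ minor))

  branches-touch : ∀ u v → u ≢ v → (Σ V λ x → Σ V λ y → branch u x × branch v y × x ~ y) ⇔ 𝓗-adj u v
  branches-touch = proj₂ (proj₂ (proj₂ minor))

  A B : Subset V
  A = branch (inj₂ false)
  B = branch (inj₂ true)

  A∩B=∅ : Disjoint G A B
  A∩B=∅ x = branches-disjoint (inj₂ false) (inj₂ true) x (λ ())

  no-A–B-edges : NoEdgesBetween G A B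
  no-A–B-edges x y Ax By x~y =
    Equivalence.to (branches-touch (inj₂ false) (inj₂ true) (λ ())) (x , y , Ax , By , x~y)

  open Component (Boundary A) B (λ By (_ , a , Aa , a~y) → no-A–B-edges a _ Aa By a~y)

  S : Subset V
  S v = Boundary A v × Σ V λ c → C c × c ~ v

  S∩A∪B=∅ : ∀ x → S x → ¬ A x × ¬ B x
  S∩A∪B=∅ x ((¬Ax , a , Aa , a~x) , _) = ¬Ax , λ Bx → no-A–B-edges a x Aa Bx a~x

  C∩A=∅ : C x → ¬ A x
  C∩A=∅ (t , Bt , w , ∂-free) = boundary-free-walk⇒outside w ∂-free (λ At → A∩B=∅ t At Bt)

  S-free-walk-into-C : (w : Walk x y) → All (λ v → ¬ S v) w → C y → C x
  S-free-walk-into-C [ _ ]        _              Cy = Cy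
  S-free-walk-into-C (x ∷⟨ e ⟩ w) (¬Sx , S-free) Cy with S-free-walk-into-C w S-free Cy | decide em (Boundary A x)
  ... | Cz | yes ∂x = ⊥-elim (¬Sx (∂x , _ , Cz , ~-sym e))
  ... | Cz | no ¬∂x = C-backward (x ∷⟨ e ⟩ [ _ ]) (¬∂x , C∩R=∅ Cz) Cz

  S-separates : IsSeparator G A B S
  S-separates (n , p , ((_ , adj) , A-start , B-end , _ , _) , S-free) with path⇒walk n p adj
  ... | w , w⊆p = C∩A=∅ (S-free-walk-into-C w (w⊆p _ S-free) (T⊆C B-end)) A-start

  S-minimal : ∀ S′ → (∀ x → S′ x → S x) → IsSeparator G A B S′ → ∀ x → S x → S′ x
  S-minimal S′ S′⊆S S′-separates s ((_ , a , Aa , a~s) , c , (b , Bb , w , ∂-free) , c~s) =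
    stable em (S′ s) λ ¬S′s →
      separator-blocks S′-separates (a ∷⟨ a~s ⟩ s ∷⟨ ~-sym c~s ⟩ w) Aa Bb
        ((λ S′a → proj₁ (S∩A∪B=∅ a (S′⊆S a S′a)) Aa) , ¬S′s ,
         All-map (λ ¬∂v S′v → ¬∂v (proj₁ (S′⊆S _ S′v))) w ∂-free)

  ¬¬branch-meets-S : ∀ n → ¬ ¬ (Σ V λ v → branch (inj₁ n) v × S v)
  ¬¬branch-meets-S n ¬meets
    with Equivalence.from (branches-touch (inj₁ n) (inj₂ false) (λ ())) tt
       | Equivalence.from (branches-touch (inj₁ n) (inj₂ true) (λ ())) tt
  ... | x , a , Bx , Aa , x~a | x′ , b , Bx′ , Bb , x′~b
    with connected⇒walk (branch-connected (inj₁ n)) Bx Bx′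
  ... | w , branch-w =
    separator-blocks S-separates (a ∷⟨ ~-sym x~a ⟩ (w ++ x′ ∷⟨ x′~b ⟩ [ b ])) Aa Bb
      ((λ Sa → proj₁ (S∩A∪B=∅ a Sa) Aa) ,
       All-++ w _ (All-map (λ {v} Bv Sv → ¬meets (v , Bv , Sv)) w branch-w) (λ Sb → proj₂ (S∩A∪B=∅ b Sb) Bb))

  branch-meets-S : ∀ n → Σ V λ v → branch (inj₁ n) v × S v
  branch-meets-S n = stable em (Σ V λ v → branch (inj₁ n) v × S v) (¬¬branch-meets-S n)

  branch-representatives-distinct : (f : ℕ → V) → (∀ n → branch (inj₁ n) (f n)) → Injective _≡_ _≡_ f
  branch-representatives-distinct f f∈branch {m} {n} fm≡fn with m ≟ n
  ... | yes m≡n = m≡n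
  ... | no m≢n  = ⊥-elim (branches-disjoint (inj₁ m) (inj₁ n) (f m) (λ eq → m≢n (inj₁-injective eq))
                    (f∈branch m) (subst (branch (inj₁ n)) (sym fm≡fn) (f∈branch n)))

  S-infinite : ¬ FiniteSet G S
  S-infinite = injection⇒¬finite {Y = S} representative
                 (branch-representatives-distinct representative (λ n → proj₁ (proj₂ (branch-meets-S n))))
                 (λ n → proj₂ (proj₂ (branch-meets-S n)))
    where
      representative : ℕ → V
      representative n = proj₁ (branch-meets-S n)

¬FiniteMinimalSeparators-of-𝓗-minor : ExcludedMiddle (lsuc 0ℓ) → (G : Graph) →
                                      IsInducedMinor 𝓗 G → ¬ FiniteMinimalSeparators G
¬FiniteMinimalSeparators-of-𝓗-minor em G minor finite =
  S-infinite (finite A B S A∩B=∅ (branch-connected (inj₂ false)) (branch-connected (inj₂ true)) no-A–B-edges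
                     (S-separates , S-minimal) S∩A∪B=∅)
  where open SeparatorOfMinor G em minor

module MinorOfInfiniteSeparator
    (G : Graph) (em : ExcludedMiddle (lsuc 0ℓ)) (chordal : Chordal G)
    (A B S : Subset (Graph.V G)) (A-connected : InducesConnected G A) (B-connected : InducesConnected G B)
    (minimal : IsMinimalSeparator G A B S) (S∩A∪B=∅ : ∀ x → S x → ¬ A x × ¬ B x)
  where
  open Graph G
  open Walks G
  open ClassicalWalks G em
  open Chordality G

  private
    variable
      x y s t : V

  separates : IsSeparator G A B S
  separates = proj₁ minimal

  module CA = Component S A (λ Ax Sx → proj₁ (S∩A∪B=∅ _ Sx) Ax)
  module CB = Component S B (λ Bx Sx → proj₂ (S∩A∪B=∅ _ Sx) Bx)

  components-separated : CA.C x → CB.C y → (w : Walk x y) → ¬ All (λ v → ¬ S v) w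
  components-separated (a , Aa , wa , S-free-a) (b , Bb , wb , S-free-b) w S-free =
    separator-blocks separates (reverse wa ++ w ++ wb) Aa Bb
      (All-++ (reverse wa) _ (All-reverse wa S-free-a)
        (All⇒AllTail (w ++ wb) (All-++ w wb S-free (All⇒AllTail wb S-free-b))))

  CA∩CB=∅ : CA.C x → ¬ CB.C x
  CA∩CB=∅ {x} CAx CBx = components-separated CAx CBx [ x ] (CA.C∩R=∅ CAx)

  no-CA–CB-edges : CA.C x → CB.C y → ¬ x ~ y
  no-CA–CB-edges {y = y} CAx CBy x~y =
    components-separated CAx CBy (_ ∷⟨ x~y ⟩ [ y ]) (CA.C∩R=∅ CAx , CB.C∩R=∅ CBy)

  S-minus-one-does-not-separate : S s → ¬ IsSeparator G A B (λ v → S v × v ≢ s)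
  S-minus-one-does-not-separate {s} Ss separates′ =
    proj₂ (proj₂ minimal (λ v → S v × v ≢ s) (λ _ → proj₁) separates′ s Ss) refl

  walk-meeting-S-only-at : S s → Σ V λ x → Σ V λ y → A x × B y × Σ (Walk x y) (All (λ v → S v → v ≡ s))
  walk-meeting-S-only-at {s} Ss with ¬separator⇒walk (S-minus-one-does-not-separate Ss)
  ... | x , y , Ax , By , w , S∖s-free =
    x , y , Ax , By , w , All-map (λ {v} ¬S∖s Sv → stable em (v ≡ s) λ v≢s → ¬S∖s (Sv , v≢s)) w S∖s-free

  neighbours : S s → (Σ V λ u → CA.C u × u ~ s) × (Σ V λ u → CB.C u × u ~ s)
  neighbours Ss with walk-meeting-S-only-at Ss
  ... | x , y , Ax , By , w , only-s =
    CA.neighbour-of-first-hit w Ax (separator-meets separates w Ax By) only-s ,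
    CB.neighbour-of-first-hit (reverse w) By (Any-reverse w (separator-meets separates w Ax By)) (All-reverse w only-s)

  -- Q, I and t form a hole: b … s … a, closed up through t.
  ¬hole-through-components :
    ∀ {s t a b} → S t → s ≢ t → ¬ s ~ t →
    (Q : Walk b s) → IsInduced Q → All (λ v → v ≡ s ⊎ CB.C v) Q → t ~ b → AllTail (λ v → ¬ t ~ v) Q →
    (I : Walk s a) → IsInduced I → All (λ v → v ≡ s ⊎ CA.C v) I → a ~ t → AllInit (λ v → ¬ v ~ t) I →
    ⊥
  ¬hole-through-components {s} {t} {a} {b} St s≢t s≁t Q Q-induced Q-in t~b Q-far I I-induced I-in a~t I-far =
    chordal-no-hole chordal t (Q ++ I) (++-induced Q I Q-induced I-induced Q-I-apart) b≢a b≁a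
      (All-++ Q I (All-map (t-outside (λ CBt → CB.C∩R=∅ CBt St)) Q Q-in)
                  (All⇒AllTail I (All-map (t-outside (λ CAt → CA.C∩R=∅ CAt St)) I I-in)))
      t~b (~-sym a~t) (AllInner-++ Q I Q-far (AllInit-map (λ ¬v~t t~v → ¬v~t (~-sym t~v)) I I-far))
    where
      t-outside : ∀ {C : Subset V} {v} → ¬ C t → v ≡ s ⊎ C v → t ≢ v
      t-outside _   (inj₁ refl) t≡s = s≢t (sym t≡s)
      t-outside ¬Ct (inj₂ Cv)   t≡v = ¬Ct (subst _ (sym t≡v) Cv)

      not-s : ∀ {C : Subset V} {v} → v ≢ s → v ≡ s ⊎ C v → C v
      not-s v≢s (inj₁ v≡s) = ⊥-elim (v≢s v≡s)
      not-s _   (inj₂ Cv)  = Cv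

      b∈CB : CB.C b
      b∈CB = not-s {C = CB.C} (λ b≡s → s≁t (~-sym (subst (t ~_) b≡s t~b))) (All-first Q Q-in)

      a∈CA : CA.C a
      a∈CA = not-s {C = CA.C} (λ a≡s → s≁t (subst (_~ t) a≡s a~t)) (All-last I I-in)

      b≢a : b ≢ a
      b≢a b≡a = CA∩CB=∅ a∈CA (subst CB.C b≡a b∈CB)

      b≁a : ¬ b ~ a
      b≁a b~a = no-CA–CB-edges a∈CA b∈CB (~-sym b~a)

      Q-I-apart : AllInit (λ u → AllTail (λ v → u ≢ v × ¬ u ~ v) I) Q
      Q-I-apart =
        AllInit-map (λ CBu → AllTail-map (λ CAv → (λ u≡v → CA∩CB=∅ CAv (subst CB.C u≡v CBu)) ,
                                                   (λ u~v → no-CA–CB-edges CAv CBu (~-sym u~v)))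
                                         I (induced-tail I I-induced I-in))
                    Q (induced-init Q Q-induced Q-in)

  S-nonadjacent⇒⊥ : S s → S t → s ≢ t → ¬ s ~ t → ⊥
  S-nonadjacent⇒⊥ {s} {t} Ss St s≢t s≁t
    with neighbours Ss | neighbours St
  ... | (u₁ , CAu₁ , u₁~s) , (v₂ , CBv₂ , v₂~s) | (u₂ , CAu₂ , u₂~t) , (v₁ , CBv₁ , v₁~t)
    with CA.C-walk A-connected CAu₁ CAu₂ | CB.C-walk B-connected CBv₁ CBv₂
  ... | wA , CA-wA | wB , CB-wB
    with induced-path-to (_~ t) (s ∷⟨ ~-sym u₁~s ⟩ wA) (Any-last (s ∷⟨ ~-sym u₁~s ⟩ wA) u₂~t)
       | induced-path-from (t ~_) (wB ++ v₂ ∷⟨ v₂~s ⟩ [ s ])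
                           (Any-first (wB ++ v₂ ∷⟨ v₂~s ⟩ [ s ]) (~-sym v₁~t))
  ... | a , I , a~t , I-induced , I-far , I⊆ | b , Q , t~b , Q-induced , Q-far , Q⊆ =
    ¬hole-through-components St s≢t s≁t
      Q Q-induced (Q⊆ _ (All-++ wB _ (All-map inj₂ wB CB-wB) (inj₁ refl))) t~b Q-far
      I I-induced (I⊆ _ (inj₁ refl , All-map inj₂ wA CA-wA)) a~t I-far

  S-clique : S s → S t → s ≢ t → s ~ t
  S-clique {s} {t} Ss St s≢t = stable em (s ~ t) (S-nonadjacent⇒⊥ Ss St s≢t)

  singleton-touches : ∀ {C : Subset V} → (Σ V λ u → C u × u ~ s) → Σ V λ x → Σ V λ y → x ≡ s × C y × x ~ y
  singleton-touches (u , Cu , u~s) = _ , u , refl , Cu , ~-sym u~s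

  touches-singleton : ∀ {C : Subset V} → (Σ V λ u → C u × u ~ s) → Σ V λ x → Σ V λ y → C x × y ≡ s × x ~ y
  touches-singleton (u , Cu , u~s) = u , _ , Cu , refl , u~s

  module _ (f : ℕ → V) (f-injective : Injective _≡_ _≡_ f) (f∈S : ∀ n → S (f n)) where

    branch : ℕ ⊎ Bool → Subset V
    branch (inj₁ n)     v = v ≡ f n
    branch (inj₂ false)   = CA.C
    branch (inj₂ true)    = CB.C

    branches-disjoint : ∀ u v x → u ≢ v → branch u x → branch v x → ⊥
    branches-disjoint (inj₁ m)     (inj₁ n)     _ m≢n refl fm≡fn = m≢n (cong inj₁ (f-injective fm≡fn))
    branches-disjoint (inj₁ n)     (inj₂ false) _ _   refl CAx   = CA.C∩R=∅ CAx (f∈S n)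
    branches-disjoint (inj₁ n)     (inj₂ true)  _ _   refl CBx   = CB.C∩R=∅ CBx (f∈S n)
    branches-disjoint (inj₂ false) (inj₁ n)     _ _   CAx  refl  = CA.C∩R=∅ CAx (f∈S n)
    branches-disjoint (inj₂ true)  (inj₁ n)     _ _   CBx  refl  = CB.C∩R=∅ CBx (f∈S n)
    branches-disjoint (inj₂ false) (inj₂ true)  _ _   CAx  CBx   = CA∩CB=∅ CAx CBx
    branches-disjoint (inj₂ true)  (inj₂ false) _ _   CBx  CAx   = CA∩CB=∅ CAx CBx
    branches-disjoint (inj₂ false) (inj₂ false) _ u≢u _    _     = u≢u refl
    branches-disjoint (inj₂ true)  (inj₂ true)  _ u≢u _    _     = u≢u refl

    branch-connected : ∀ u → InducesConnected G (branch u)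
    branch-connected (inj₁ n)     = walks⇒connected (f n , refl) λ { refl refl → [ f n ] , refl }
    branch-connected (inj₂ false) = CA.C-connected A-connected
    branch-connected (inj₂ true)  = CB.C-connected B-connected

    branches-touch : ∀ u v → u ≢ v → (Σ V λ x → Σ V λ y → branch u x × branch v y × x ~ y) ⇔ 𝓗-adj u v
    branches-touch (inj₁ m) (inj₁ n) m≢n =
      mk⇔ (λ _ m≡n → m≢n (cong inj₁ m≡n))
          (λ m≢n′ → f m , f n , refl , refl ,
                    S-clique (f∈S m) (f∈S n) (λ fm≡fn → m≢n′ (f-injective fm≡fn)))
    branches-touch (inj₁ n) (inj₂ false) _ =
      mk⇔ (λ _ → tt) (λ _ → singleton-touches (proj₁ (neighbours (f∈S n))))
    branches-touch (inj₁ n) (inj₂ true)  _ =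
      mk⇔ (λ _ → tt) (λ _ → singleton-touches (proj₂ (neighbours (f∈S n))))
    branches-touch (inj₂ false) (inj₁ n) _ =
      mk⇔ (λ _ → tt) (λ _ → touches-singleton (proj₁ (neighbours (f∈S n))))
    branches-touch (inj₂ true)  (inj₁ n) _ =
      mk⇔ (λ _ → tt) (λ _ → touches-singleton (proj₂ (neighbours (f∈S n))))
    branches-touch (inj₂ false) (inj₂ true) _ =
      mk⇔ (λ (x , y , CAx , CBy , x~y) → no-CA–CB-edges CAx CBy x~y) λ ()
    branches-touch (inj₂ true) (inj₂ false) _ =
      mk⇔ (λ (x , y , CBx , CAy , x~y) → no-CA–CB-edges CAy CBx (~-sym x~y)) λ ()
    branches-touch (inj₂ false) (inj₂ false) u≢u = ⊥-elim (u≢u refl)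
    branches-touch (inj₂ true)  (inj₂ true)  u≢u = ⊥-elim (u≢u refl)

    𝓗-minor : IsInducedMinor 𝓗 G
    𝓗-minor = branch , branches-disjoint , branch-connected , branches-touch

𝓗-minor-of-infinite-minimal-separator :
  ExcludedMiddle (lsuc 0ℓ) → (G : Graph) → Chordal G → ∀ (A B S : Subset (Graph.V G)) →
  InducesConnected G A → InducesConnected G B → IsMinimalSeparator G A B S →
  (∀ x → S x → ¬ A x × ¬ B x) → ¬ FiniteSet G S → IsInducedMinor 𝓗 G
𝓗-minor-of-infinite-minimal-separator em G chordal A B S A-connected B-connected minimal S∩A∪B=∅ infinite
  with ¬finite⇒injection {Y = S} em infinite
... | f , f-injective , f∈S = 𝓗-minor f f-injective f∈S
  where open MinorOfInfiniteSeparator G em chordal A B S A-connected B-connected minimal S∩A∪B=∅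

lemma3p5 : ExcludedMiddle (lsuc 0ℓ) →
    (G : Graph) → Chordal G →
      (¬ IsInducedMinor 𝓗 G)
        ⇔ (∀ (A B S : Subset (Graph.V G)) →
             Disjoint G A B → InducesConnected G A → InducesConnected G B →
             NoEdgesBetween G A B →
             IsMinimalSeparator G A B S →
             (∀ x → S x → ¬ A x × ¬ B x) →
             FiniteSet G S)
lemma3p5 em G chordal =
  mk⇔ separators-finite (λ finite minor → ¬FiniteMinimalSeparators-of-𝓗-minor em G minor finite)
  where
    separators-finite : ¬ IsInducedMinor 𝓗 G → FiniteMinimalSeparators G
    separators-finite ¬minor A B S _ A-connected B-connected _ minimal S∩A∪B=∅ =
      stable em (FiniteSet G S) λ infinite →
        ¬minor (𝓗-minor-of-infinite-minimal-separator em G chordal A B S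
                  A-connected B-connected minimal S∩A∪B=∅ infinite)
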